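{- Let $\Sigma=\{0,1\}$ and let $\varepsilon$ denote the empty word. Suppose $\varphi:\Sigma^*\times\Sigma^*\to{\rm SL}(3,\mathbb{C})$ is an injective morphism, and let $A=\varphi((0,\varepsilon))$, $B=\varphi((1,\varepsilon))$, $C=\varphi((\varepsilon,0))$, $D=\varphi((\varepsilon,1))$. Then none of $A,B,C,D$ has a Jordan normal form of the type $\begin{pmatrix}\lambda&0&0\\0&\mu&1\\0&0&\mu\end{pmatrix}$ with $\lambda\neq\mu$.
   Context: $\Sigma^*\times\Sigma^*$ is the direct product monoid of pairs of words with componentwise concatenation; a morphism is a map $\varphi$ with $\varphi(xy)=\varphi(x)\varphi(y)$. ${\rm SL}(3,\mathbb{C})$ is the group of complex $3\times 3$ matrices of determinant $1$. -}

module Defs where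

open import Level using (Level; _⊔_) renaming (suc to lsuc)
open import Algebra.Bundles using (CommutativeRing)
open import Data.Nat using (ℕ; zero; suc)
open import Data.Fin using (Fin; zero; suc)
open import Data.List using (List; []; _∷_; _++_)
open import Data.Product using (_×_; _,_; ∃)
open import Relation.Nullary using (¬_)
open import Relation.Binary.PropositionalEquality using (_≡_)

-- Σ = {0,1}; words are lists over Fin 2 (zero = letter 0, suc zero = letter 1)
Σ : Set
Σ = Fin 2

Word : Set
Word = List Σ

WordPair : Set
WordPair = Word × Word

_·_ : WordPair → WordPair → WordPair
(u , v) · (u' , v') = (u ++ u') , (v ++ v')

module RingOps {c ℓ : Level} (R : CommutativeRing c ℓ) where
  open CommutativeRing R

  ofℕ : ℕ → Carrier
  ofℕ zero = 0#
  ofℕ (suc n) = 1# + ofℕ n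

  -- monic polynomial x^n + a_{n-1} x^{n-1} + ... + a_0, coefficients given as
  -- the list (a_{n-1} ∷ ... ∷ a_0 ∷ [])  (Horner scheme)
  evalMonic : List Carrier → Carrier → Carrier
  evalMonic [] x = 1#
  evalMonic (a ∷ as) x = evalMonic as x * x + a

-- An algebraically closed field of characteristic 0 (standing in for ℂ)
record AlgClosedChar0Field (c ℓ : Level) : Set (lsuc (c ⊔ ℓ)) where
  field
    cring : CommutativeRing c ℓ
  open CommutativeRing cring
  open RingOps cring
  field
    0≉1 : ¬ (0# ≈ 1#)
    inverse : ∀ x → ¬ (x ≈ 0#) → ∃ λ y → x * y ≈ 1#
    char0 : ∀ n → ¬ (ofℕ (suc n) ≈ 0#)
    algClosed : ∀ (a : Carrier) (as : List Carrier) → ∃ λ x → evalMonic (a ∷ as) x ≈ 0#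

module Matrices {c ℓ : Level} (K : AlgClosedChar0Field c ℓ) where
  open AlgClosedChar0Field K
  open CommutativeRing cring using (Carrier; _≈_; _+_; _*_; _-_; 0#; 1#)

  Mat3 : Set c
  Mat3 = Fin 3 → Fin 3 → Carrier

  f0 f1 f2 : Fin 3
  f0 = zero
  f1 = suc zero
  f2 = suc (suc zero)

  _≈M_ : Mat3 → Mat3 → Set ℓ
  M ≈M N = ∀ i j → M i j ≈ N i j

  _⊗_ : Mat3 → Mat3 → Mat3
  (M ⊗ N) i j = M i f0 * N f0 j + M i f1 * N f1 j + M i f2 * N f2 j

  I3 : Mat3
  I3 zero zero = 1#
  I3 (suc zero) (suc zero) = 1#
  I3 (suc (suc zero)) (suc (suc zero)) = 1#
  I3 _ _ = 0#

  det : Mat3 → Carrier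
  det M =
      M f0 f0 * (M f1 f1 * M f2 f2 - M f1 f2 * M f2 f1)
    - M f0 f1 * (M f1 f0 * M f2 f2 - M f1 f2 * M f2 f0)
    + M f0 f2 * (M f1 f0 * M f2 f1 - M f1 f1 * M f2 f0)

  InSL3 : Mat3 → Set ℓ
  InSL3 M = det M ≈ 1#

  jordan : Carrier → Carrier → Mat3
  jordan l m zero zero = l
  jordan l m (suc zero) (suc zero) = m
  jordan l m (suc zero) (suc (suc zero)) = 1#
  jordan l m (suc (suc zero)) (suc (suc zero)) = m
  jordan l m _ _ = 0#

  HasJordanType : Mat3 → Set (c ⊔ ℓ)
  HasJordanType M =
    ∃ λ l → ∃ λ m → ¬ (l ≈ m) × ∃ λ P → ∃ λ Q →
      (P ⊗ Q) ≈M I3 × (Q ⊗ P) ≈M I3 × ((Q ⊗ M) ⊗ P) ≈M jordan l m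

  record InjMorphism : Set (c ⊔ ℓ) where
    field
      φ : WordPair → Mat3
      inSL : ∀ w → InSL3 (φ w)
      hom : ∀ x y → φ (x · y) ≈M (φ x ⊗ φ y)
      inj : ∀ x y → φ x ≈M φ y → x ≡ y

-- Conjugate a matrix of Jordan type diag(λ) ⊕ J₂(μ), λ ≠ μ, to its Jordan form J. Comparing
-- entries of XJ = JX, the condition λ ≠ μ forces every X commuting with J into the shape
-- diag(a) ⊕ [[b, c], [0, b]], and such matrices commute pairwise; so the centraliser of a
-- matrix of this Jordan type is commutative. In Σ* × Σ*, (ε,0) and (ε,1) both commute with
-- every (u,ε) but not with each other; an injective morphism preserves and reflects
-- commutation, so no φ((u,ε)) has this Jordan type, and symmetrically for (ε,v).
module Submission where

open import Level using (Level)
open import Algebra.Bundles using (CommutativeRing)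
open import Data.Fin using (zero; suc)
open import Data.List using ([]; _∷_)
open import Data.List.Properties using (++-identityʳ)
open import Data.Product using (_,_; _×_)
open import Relation.Binary.Bundles using (Setoid)
open import Relation.Binary.PropositionalEquality as ≡ using (_≡_; _≢_)
open import Relation.Nullary using (¬_)
import Algebra.Properties.Group as GroupProperties
import Algebra.Properties.Ring as RingProperties
import Algebra.Solver.Ring.NaturalCoefficients.Default as NaturalSolver
import Relation.Binary.Reasoning.Setoid as SetoidReasoning
open import Defs

left-right-·-comm : ∀ (u v : Word) → (u , []) · ([] , v) ≡ ([] , v) · (u , [])
left-right-·-comm u v = ≡.cong₂ _,_ (++-identityʳ u) (≡.sym (++-identityʳ v))

module _ {c ℓ : Level} (K : AlgClosedChar0Field c ℓ) where
  open AlgClosedChar0Field K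
  open CommutativeRing cring hiding (zero)
  open Matrices K
  open NaturalSolver commutativeSemiring using (solve; _:+_; _:*_; _:=_; con)
  open GroupProperties +-group using (x∙y⁻¹≈ε⇒x≈y; ∙-cancelˡ; identityʳ-unique)
  open RingProperties ring using (-‿distribˡ-*)

  module ≈-Reasoning = SetoidReasoning setoid

  l*x≈m*x⇒x≈0 : ∀ {l m x} → ¬ l ≈ m → l * x ≈ m * x → x ≈ 0#
  l*x≈m*x⇒x≈0 {l} {m} {x} l≉m lx≈mx with inverse (l - m) (λ l-m≈0 → l≉m (x∙y⁻¹≈ε⇒x≈y l m l-m≈0))
  ... | y , [l-m]y≈1 = begin
    x                   ≈⟨ *-identityˡ x ⟨
    1# * x              ≈⟨ *-congʳ (trans (sym [l-m]y≈1) (*-comm (l - m) y)) ⟩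
    (y * (l - m)) * x   ≈⟨ *-assoc y (l - m) x ⟩
    y * ((l - m) * x)   ≈⟨ *-congˡ [l-m]x≈0 ⟩
    y * 0#              ≈⟨ zeroʳ y ⟩
    0#                  ∎
    where
    open ≈-Reasoning
    [l-m]x≈0 : (l - m) * x ≈ 0#
    [l-m]x≈0 = begin
      (l - m) * x         ≈⟨ distribʳ x l (- m) ⟩
      l * x + - m * x     ≈⟨ +-congˡ (-‿distribˡ-* m x) ⟨
      l * x - m * x       ≈⟨ +-congʳ lx≈mx ⟩
      m * x - m * x       ≈⟨ -‿inverseʳ (m * x) ⟩
      0#                  ∎

  matSetoid : Setoid c ℓ
  matSetoid = record
    { Carrier = Mat3
    ; _≈_ = _≈M_
    ; isEquivalence = record
      { refl = λ i j → refl
      ; sym = λ p i j → sym (p i j)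
      ; trans = λ p q i j → trans (p i j) (q i j)
      }
    }

  open Setoid matSetoid using () renaming (refl to ≈M-refl; sym to ≈M-sym; trans to ≈M-trans)
  module ≈M-Reasoning = SetoidReasoning matSetoid

  ⊗-cong : ∀ {M M' N N'} → M ≈M M' → N ≈M N' → (M ⊗ N) ≈M (M' ⊗ N')
  ⊗-cong p q i j =
    +-cong (+-cong (*-cong (p i f0) (q f0 j)) (*-cong (p i f1) (q f1 j))) (*-cong (p i f2) (q f2 j))

  ⊗-congˡ : ∀ M {N N'} → N ≈M N' → (M ⊗ N) ≈M (M ⊗ N')
  ⊗-congˡ M = ⊗-cong {M} ≈M-refl

  ⊗-congʳ : ∀ N {M M'} → M ≈M M' → (M ⊗ N) ≈M (M' ⊗ N)
  ⊗-congʳ N p = ⊗-cong {N = N} p ≈M-refl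

  ⊗-assoc : ∀ M N P → ((M ⊗ N) ⊗ P) ≈M (M ⊗ (N ⊗ P))
  ⊗-assoc M N P i j = solve 15
    (λ m₀ m₁ m₂ n₀₀ n₀₁ n₀₂ n₁₀ n₁₁ n₁₂ n₂₀ n₂₁ n₂₂ p₀ p₁ p₂ →
        (m₀ :* n₀₀ :+ m₁ :* n₁₀ :+ m₂ :* n₂₀) :* p₀
      :+ (m₀ :* n₀₁ :+ m₁ :* n₁₁ :+ m₂ :* n₂₁) :* p₁
      :+ (m₀ :* n₀₂ :+ m₁ :* n₁₂ :+ m₂ :* n₂₂) :* p₂
      := m₀ :* (n₀₀ :* p₀ :+ n₀₁ :* p₁ :+ n₀₂ :* p₂)
      :+ m₁ :* (n₁₀ :* p₀ :+ n₁₁ :* p₁ :+ n₁₂ :* p₂)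
      :+ m₂ :* (n₂₀ :* p₀ :+ n₂₁ :* p₁ :+ n₂₂ :* p₂))
    refl
    (M i f0) (M i f1) (M i f2)
    (N f0 f0) (N f0 f1) (N f0 f2) (N f1 f0) (N f1 f1) (N f1 f2) (N f2 f0) (N f2 f1) (N f2 f2)
    (P f0 j) (P f1 j) (P f2 j)

  ⊗-identityˡ : ∀ M → (I3 ⊗ M) ≈M M
  ⊗-identityˡ M zero j =
    solve 3 (λ x y z → con 1 :* x :+ con 0 :* y :+ con 0 :* z := x) refl _ _ _
  ⊗-identityˡ M (suc zero) j =
    solve 3 (λ x y z → con 0 :* x :+ con 1 :* y :+ con 0 :* z := y) refl _ _ _
  ⊗-identityˡ M (suc (suc zero)) j =
    solve 3 (λ x y z → con 0 :* x :+ con 0 :* y :+ con 1 :* z := z) refl _ _ _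

  ⊗-identityʳ : ∀ M → (M ⊗ I3) ≈M M
  ⊗-identityʳ M i zero =
    solve 3 (λ x y z → x :* con 1 :+ y :* con 0 :+ z :* con 0 := x) refl _ _ _
  ⊗-identityʳ M i (suc zero) =
    solve 3 (λ x y z → x :* con 0 :+ y :* con 1 :+ z :* con 0 := y) refl _ _ _
  ⊗-identityʳ M i (suc (suc zero)) =
    solve 3 (λ x y z → x :* con 0 :+ y :* con 0 :+ z :* con 1 := z) refl _ _ _

  Commute : Mat3 → Mat3 → Set ℓ
  Commute X Y = (X ⊗ Y) ≈M (Y ⊗ X)

  Commute-resp : ∀ {X X' Y Y'} → X ≈M X' → Y ≈M Y' → Commute X Y → Commute X' Y'
  Commute-resp {X} {X'} {Y} {Y'} X≈X' Y≈Y' XY≈YX = begin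
    X' ⊗ Y'   ≈⟨ ⊗-cong {X} {X'} {Y} {Y'} X≈X' Y≈Y' ⟨
    X ⊗ Y     ≈⟨ XY≈YX ⟩
    Y ⊗ X     ≈⟨ ⊗-cong {Y} {Y'} {X} {X'} Y≈Y' X≈X' ⟩
    Y' ⊗ X'   ∎
    where open ≈M-Reasoning

  module Conjugation (P Q : Mat3) (P⊗Q≈I : (P ⊗ Q) ≈M I3) where

    conj : Mat3 → Mat3
    conj U = (Q ⊗ U) ⊗ P

    P⊗conj : ∀ U → (P ⊗ conj U) ≈M (U ⊗ P)
    P⊗conj U = begin
      P ⊗ ((Q ⊗ U) ⊗ P)   ≈⟨ ⊗-assoc P (Q ⊗ U) P ⟨
      (P ⊗ (Q ⊗ U)) ⊗ P   ≈⟨ ⊗-congʳ P (⊗-assoc P Q U) ⟨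
      ((P ⊗ Q) ⊗ U) ⊗ P   ≈⟨ ⊗-congʳ P (⊗-congʳ U P⊗Q≈I) ⟩
      (I3 ⊗ U) ⊗ P        ≈⟨ ⊗-congʳ P (⊗-identityˡ U) ⟩
      U ⊗ P               ∎
      where open ≈M-Reasoning

    conj-⊗ : ∀ U V → conj (U ⊗ V) ≈M (conj U ⊗ conj V)
    conj-⊗ U V = begin
      (Q ⊗ (U ⊗ V)) ⊗ P       ≈⟨ ⊗-congʳ P (⊗-assoc Q U V) ⟨
      ((Q ⊗ U) ⊗ V) ⊗ P       ≈⟨ ⊗-assoc (Q ⊗ U) V P ⟩
      (Q ⊗ U) ⊗ (V ⊗ P)       ≈⟨ ⊗-congˡ (Q ⊗ U) (P⊗conj V) ⟨
      (Q ⊗ U) ⊗ (P ⊗ conj V)  ≈⟨ ⊗-assoc (Q ⊗ U) P (conj V) ⟨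
      conj U ⊗ conj V         ∎
      where open ≈M-Reasoning

    conj-injective : ∀ {U V} → conj U ≈M conj V → U ≈M V
    conj-injective {U} {V} conjU≈conjV = begin
      U                  ≈⟨ unconj U ⟨
      (P ⊗ conj U) ⊗ Q   ≈⟨ ⊗-congʳ Q (⊗-congˡ P conjU≈conjV) ⟩
      (P ⊗ conj V) ⊗ Q   ≈⟨ unconj V ⟩
      V                  ∎
      where
      open ≈M-Reasoning
      unconj : ∀ W → ((P ⊗ conj W) ⊗ Q) ≈M W
      unconj W = begin
        (P ⊗ conj W) ⊗ Q   ≈⟨ ⊗-congʳ Q (P⊗conj W) ⟩
        (W ⊗ P) ⊗ Q        ≈⟨ ⊗-assoc W P Q ⟩
        W ⊗ (P ⊗ Q)        ≈⟨ ⊗-congˡ W P⊗Q≈I ⟩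
        W ⊗ I3             ≈⟨ ⊗-identityʳ W ⟩
        W                  ∎

    conj-Commute : ∀ {U V} → Commute U V → Commute (conj U) (conj V)
    conj-Commute {U} {V} UV≈VU = begin
      conj U ⊗ conj V   ≈⟨ conj-⊗ U V ⟨
      conj (U ⊗ V)      ≈⟨ ⊗-congʳ P (⊗-congˡ Q UV≈VU) ⟩
      conj (V ⊗ U)      ≈⟨ conj-⊗ V U ⟩
      conj V ⊗ conj U   ∎
      where open ≈M-Reasoning

    conj-Commute⁻¹ : ∀ {U V} → Commute (conj U) (conj V) → Commute U V
    conj-Commute⁻¹ {U} {V} comm = conj-injective (begin
      conj (U ⊗ V)      ≈⟨ conj-⊗ U V ⟩
      conj U ⊗ conj V   ≈⟨ comm ⟩
      conj V ⊗ conj U   ≈⟨ conj-⊗ V U ⟨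
      conj (V ⊗ U)      ∎)
      where open ≈M-Reasoning

  blockJordan : Carrier → Carrier → Carrier → Mat3
  blockJordan α β γ zero zero = α
  blockJordan α β γ (suc zero) (suc zero) = β
  blockJordan α β γ (suc zero) (suc (suc zero)) = γ
  blockJordan α β γ (suc (suc zero)) (suc (suc zero)) = β
  blockJordan α β γ _ _ = 0#

  jordan≈blockJordan : ∀ l m → jordan l m ≈M blockJordan l m 1#
  jordan≈blockJordan l m zero zero = refl
  jordan≈blockJordan l m zero (suc j) = refl
  jordan≈blockJordan l m (suc zero) zero = refl
  jordan≈blockJordan l m (suc zero) (suc zero) = refl
  jordan≈blockJordan l m (suc zero) (suc (suc zero)) = refl
  jordan≈blockJordan l m (suc (suc zero)) zero = refl
  jordan≈blockJordan l m (suc (suc zero)) (suc zero) = refl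
  jordan≈blockJordan l m (suc (suc zero)) (suc (suc zero)) = refl

  blockJordan-cong : ∀ {α α' β β' γ γ'} → α ≈ α' → β ≈ β' → γ ≈ γ' →
    blockJordan α β γ ≈M blockJordan α' β' γ'
  blockJordan-cong α≈α' β≈β' γ≈γ' zero zero = α≈α'
  blockJordan-cong α≈α' β≈β' γ≈γ' zero (suc j) = refl
  blockJordan-cong α≈α' β≈β' γ≈γ' (suc zero) zero = refl
  blockJordan-cong α≈α' β≈β' γ≈γ' (suc zero) (suc zero) = β≈β'
  blockJordan-cong α≈α' β≈β' γ≈γ' (suc zero) (suc (suc zero)) = γ≈γ'
  blockJordan-cong α≈α' β≈β' γ≈γ' (suc (suc zero)) zero = refl
  blockJordan-cong α≈α' β≈β' γ≈γ' (suc (suc zero)) (suc zero) = refl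
  blockJordan-cong α≈α' β≈β' γ≈γ' (suc (suc zero)) (suc (suc zero)) = β≈β'

  blockJordanMulˡ : Carrier → Carrier → Carrier → Mat3 → Mat3
  blockJordanMulˡ α β γ X zero j = α * X f0 j
  blockJordanMulˡ α β γ X (suc zero) j = β * X f1 j + γ * X f2 j
  blockJordanMulˡ α β γ X (suc (suc zero)) j = β * X f2 j

  blockJordanMulʳ : Mat3 → Carrier → Carrier → Carrier → Mat3
  blockJordanMulʳ X α β γ i zero = α * X i f0
  blockJordanMulʳ X α β γ i (suc zero) = β * X i f1
  blockJordanMulʳ X α β γ i (suc (suc zero)) = γ * X i f1 + β * X i f2

  blockJordan-⊗ : ∀ α β γ X → (blockJordan α β γ ⊗ X) ≈M blockJordanMulˡ α β γ X
  blockJordan-⊗ α β γ X zero j =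
    solve 4 (λ α x y z → α :* x :+ con 0 :* y :+ con 0 :* z := α :* x) refl _ _ _ _
  blockJordan-⊗ α β γ X (suc zero) j =
    solve 5 (λ β γ x y z → con 0 :* x :+ β :* y :+ γ :* z := β :* y :+ γ :* z) refl _ _ _ _ _
  blockJordan-⊗ α β γ X (suc (suc zero)) j =
    solve 4 (λ β x y z → con 0 :* x :+ con 0 :* y :+ β :* z := β :* z) refl _ _ _ _

  ⊗-blockJordan : ∀ X α β γ → (X ⊗ blockJordan α β γ) ≈M blockJordanMulʳ X α β γ
  ⊗-blockJordan X α β γ i zero =
    solve 4 (λ α x y z → x :* α :+ y :* con 0 :+ z :* con 0 := α :* x) refl _ _ _ _
  ⊗-blockJordan X α β γ i (suc zero) =
    solve 4 (λ β x y z → x :* con 0 :+ y :* β :+ z :* con 0 := β :* y) refl _ _ _ _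
  ⊗-blockJordan X α β γ i (suc (suc zero)) =
    solve 5 (λ β γ x y z → x :* con 0 :+ y :* γ :+ z :* β := γ :* y :+ β :* z) refl _ _ _ _ _

  blockJordan-⊗-blockJordan : ∀ α β γ α' β' γ' →
    (blockJordan α β γ ⊗ blockJordan α' β' γ')
      ≈M blockJordan (α * α') (β * β') (β * γ' + γ * β')
  blockJordan-⊗-blockJordan α β γ α' β' γ' =
    ≈M-trans (blockJordan-⊗ α β γ (blockJordan α' β' γ')) entries
    where
    entries : blockJordanMulˡ α β γ (blockJordan α' β' γ')
                ≈M blockJordan (α * α') (β * β') (β * γ' + γ * β')
    entries zero zero = refl
    entries zero (suc zero) = zeroʳ α
    entries zero (suc (suc zero)) = zeroʳ α
    entries (suc zero) zero = trans (+-cong (zeroʳ β) (zeroʳ γ)) (+-identityʳ 0#)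
    entries (suc zero) (suc zero) = trans (+-congˡ (zeroʳ γ)) (+-identityʳ (β * β'))
    entries (suc zero) (suc (suc zero)) = refl
    entries (suc (suc zero)) zero = zeroʳ β
    entries (suc (suc zero)) (suc zero) = zeroʳ β
    entries (suc (suc zero)) (suc (suc zero)) = refl

  blockJordan-Commute : ∀ α β γ α' β' γ' → Commute (blockJordan α β γ) (blockJordan α' β' γ')
  blockJordan-Commute α β γ α' β' γ' = begin
    blockJordan α β γ ⊗ blockJordan α' β' γ'
      ≈⟨ blockJordan-⊗-blockJordan α β γ α' β' γ' ⟩
    blockJordan (α * α') (β * β') (β * γ' + γ * β')
      ≈⟨ blockJordan-cong (*-comm α α') (*-comm β β') γ-entry ⟩
    blockJordan (α' * α) (β' * β) (β' * γ + γ' * β)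
      ≈⟨ blockJordan-⊗-blockJordan α' β' γ' α β γ ⟨
    blockJordan α' β' γ' ⊗ blockJordan α β γ
      ∎
    where
    open ≈M-Reasoning
    γ-entry : β * γ' + γ * β' ≈ β' * γ + γ' * β
    γ-entry = trans (+-comm (β * γ') (γ * β')) (+-cong (*-comm γ β') (*-comm β γ'))

  Commute-jordan⇒blockJordan : ∀ {l m} X → ¬ l ≈ m → Commute X (jordan l m) →
    X ≈M blockJordan (X f0 f0) (X f1 f1) (X f1 f2)
  Commute-jordan⇒blockJordan {l} {m} X l≉m XJ≈JX = entries
    where
    J≈B : jordan l m ≈M blockJordan l m 1#
    J≈B = jordan≈blockJordan l m

    XJ≈JX-explicit : blockJordanMulʳ X l m 1# ≈M blockJordanMulˡ l m 1# X
    XJ≈JX-explicit = begin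
      blockJordanMulʳ X l m 1#    ≈⟨ ⊗-blockJordan X l m 1# ⟨
      X ⊗ blockJordan l m 1#      ≈⟨ ⊗-congˡ X J≈B ⟨
      X ⊗ jordan l m              ≈⟨ XJ≈JX ⟩
      jordan l m ⊗ X              ≈⟨ ⊗-congʳ X J≈B ⟩
      blockJordan l m 1# ⊗ X      ≈⟨ blockJordan-⊗ l m 1# X ⟩
      blockJordanMulˡ l m 1# X    ∎
      where open ≈M-Reasoning

    m≉l : ¬ m ≈ l
    m≉l m≈l = l≉m (sym m≈l)

    X₀₁≈0 : X f0 f1 ≈ 0#
    X₀₁≈0 = l*x≈m*x⇒x≈0 m≉l (XJ≈JX-explicit f0 f1)

    X₀₂≈0 : X f0 f2 ≈ 0#
    X₀₂≈0 = l*x≈m*x⇒x≈0 m≉l (begin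
      m * X f0 f2                 ≈⟨ +-identityˡ _ ⟨
      0# + m * X f0 f2            ≈⟨ +-congʳ (trans (*-identityˡ _) X₀₁≈0) ⟨
      1# * X f0 f1 + m * X f0 f2  ≈⟨ XJ≈JX-explicit f0 f2 ⟩
      l * X f0 f2                 ∎)
      where open ≈-Reasoning

    X₂₀≈0 : X f2 f0 ≈ 0#
    X₂₀≈0 = l*x≈m*x⇒x≈0 l≉m (XJ≈JX-explicit f2 f0)

    X₁₀≈0 : X f1 f0 ≈ 0#
    X₁₀≈0 = l*x≈m*x⇒x≈0 l≉m (begin
      l * X f1 f0                 ≈⟨ XJ≈JX-explicit f1 f0 ⟩
      m * X f1 f0 + 1# * X f2 f0  ≈⟨ +-congˡ (trans (*-identityˡ _) X₂₀≈0) ⟩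
      m * X f1 f0 + 0#            ≈⟨ +-identityʳ _ ⟩
      m * X f1 f0                 ∎)
      where open ≈-Reasoning

    X₂₁≈0 : X f2 f1 ≈ 0#
    X₂₁≈0 = trans (sym (*-identityˡ _)) (identityʳ-unique _ _ (sym (XJ≈JX-explicit f1 f1)))

    X₁₁≈X₂₂ : X f1 f1 ≈ X f2 f2
    X₁₁≈X₂₂ = begin
      X f1 f1         ≈⟨ *-identityˡ _ ⟨
      1# * X f1 f1    ≈⟨ ∙-cancelˡ (m * X f1 f2) _ _ (trans (+-comm _ _) (XJ≈JX-explicit f1 f2)) ⟩
      1# * X f2 f2    ≈⟨ *-identityˡ _ ⟩
      X f2 f2         ∎
      where open ≈-Reasoning

    entries : X ≈M blockJordan (X f0 f0) (X f1 f1) (X f1 f2)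
    entries zero zero = refl
    entries zero (suc zero) = X₀₁≈0
    entries zero (suc (suc zero)) = X₀₂≈0
    entries (suc zero) zero = X₁₀≈0
    entries (suc zero) (suc zero) = refl
    entries (suc zero) (suc (suc zero)) = refl
    entries (suc (suc zero)) zero = X₂₀≈0
    entries (suc (suc zero)) (suc zero) = X₂₁≈0
    entries (suc (suc zero)) (suc (suc zero)) = sym X₁₁≈X₂₂

  centraliser-of-jordanType-Commute : ∀ {M X Y} → HasJordanType M →
    Commute X M → Commute Y M → Commute X Y
  centraliser-of-jordanType-Commute {M} {X} {Y}
    (l , m , l≉m , P , Q , P⊗Q≈I , _ , conjM≈J) XM≈MX YM≈MY =
      conj-Commute⁻¹ {X} {Y} (Commute-resp {X' = conj X} {Y' = conj Y}
        (≈M-sym (toBlockJordan X XM≈MX)) (≈M-sym (toBlockJordan Y YM≈MY))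
        (blockJordan-Commute _ _ _ _ _ _))
    where
    open Conjugation P Q P⊗Q≈I
    toBlockJordan : ∀ Z → Commute Z M →
      conj Z ≈M blockJordan (conj Z f0 f0) (conj Z f1 f1) (conj Z f1 f2)
    toBlockJordan Z ZM≈MZ = Commute-jordan⇒blockJordan (conj Z) l≉m
      (Commute-resp {X' = conj Z} {Y' = jordan l m} ≈M-refl conjM≈J (conj-Commute {Z} {M} ZM≈MZ))

  module _ (Φ : InjMorphism) where
    open InjMorphism Φ

    φ-Commute : ∀ x y → x · y ≡ y · x → Commute (φ x) (φ y)
    φ-Commute x y xy≡yx = begin
      φ x ⊗ φ y   ≈⟨ hom x y ⟨
      φ (x · y)   ≡⟨ ≡.cong φ xy≡yx ⟩
      φ (y · x)   ≈⟨ hom y x ⟩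
      φ y ⊗ φ x   ∎
      where open ≈M-Reasoning

    φ-Commute⁻¹ : ∀ x y → Commute (φ x) (φ y) → x · y ≡ y · x
    φ-Commute⁻¹ x y φxφy≈φyφx = inj (x · y) (y · x) (begin
      φ (x · y)   ≈⟨ hom x y ⟩
      φ x ⊗ φ y   ≈⟨ φxφy≈φyφx ⟩
      φ y ⊗ φ x   ≈⟨ hom y x ⟨
      φ (y · x)   ∎)
      where open ≈M-Reasoning

    noncommutative-centraliser⇒¬HasJordanType : ∀ w x y →
      x · w ≡ w · x → y · w ≡ w · y → x · y ≢ y · x → ¬ HasJordanType (φ w)
    noncommutative-centraliser⇒¬HasJordanType w x y xw≡wx yw≡wy xy≢yx jordanType =
      xy≢yx (φ-Commute⁻¹ x y (centraliser-of-jordanType-Commute {φ w} {φ x} {φ y} jordanType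
        (φ-Commute x w xw≡wx) (φ-Commute y w yw≡wy)))

    left-¬HasJordanType : ∀ u → ¬ HasJordanType (φ (u , []))
    left-¬HasJordanType u = noncommutative-centraliser⇒¬HasJordanType
      (u , []) ([] , zero ∷ []) ([] , suc zero ∷ [])
      (≡.sym (left-right-·-comm u _)) (≡.sym (left-right-·-comm u _)) (λ ())

    right-¬HasJordanType : ∀ v → ¬ HasJordanType (φ ([] , v))
    right-¬HasJordanType v = noncommutative-centraliser⇒¬HasJordanType
      ([] , v) (zero ∷ [] , []) (suc zero ∷ [] , [])
      (left-right-·-comm _ v) (left-right-·-comm _ v) (λ ())

lemma5 : ∀ {c ℓ : Level} (K : AlgClosedChar0Field c ℓ) →
    let open Matrices K in
    (Φ : InjMorphism) →
    let open InjMorphism Φ in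
    (¬ HasJordanType (φ ((zero ∷ []) , [])))
    × (¬ HasJordanType (φ ((suc zero ∷ []) , [])))
    × (¬ HasJordanType (φ ([] , (zero ∷ []))))
    × (¬ HasJordanType (φ ([] , (suc zero ∷ []))))
lemma5 K Φ =
    left-¬HasJordanType K Φ (zero ∷ [])
  , left-¬HasJordanType K Φ (suc zero ∷ [])
  , right-¬HasJordanType K Φ (zero ∷ [])
  , right-¬HasJordanType K Φ (suc zero ∷ [])
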